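{- Let $k\ge1$. The first $k+1$ terms of the sequence $(s_{k,n})_{n=1}^\infty$ are $1,2,\ldots,2^{k-1},2^k-1$, i.e., $s_{k,n}=2^{n-1}$ for $1\le n\le k$ and $s_{k,k+1}=2^k-1$. Moreover, $$s_{k,n}=\sum_{i=1}^k(-1)^{i+1}\binom{k}{i}s_{k,n-i}+s_{k,n-k-1}\quad\text{for all } n\ge k+2.$$
   Context: A finite nonempty set $F\subset\mathbb{N}$ is called Schreier if $\min F\ge |F|$. For $k,n\in\mathbb{N}$, let $s_{k,n}$ be the number of sets $F\subset\{k,2k,\ldots,nk\}$ such that $F$ is Schreier and $nk\in F$. -}

module Defs where

open import Data.Bool using (Bool; true; false; _∧_)
open import Data.Nat using (ℕ; zero; suc; _*_; _⊓_; _≤ᵇ_; _≡ᵇ_)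
open import Data.List using (List; []; _∷_; _++_; map; length; foldr; filterᵇ; applyUpTo)
open import Data.Bool.ListAction using (any)

-- All sublists (subsets, as order-preserving sublists) of a list.
-- For a list of distinct elements, these correspond bijectively to its subsets.
sublists : {A : Set} → List A → List (List A)
sublists []       = [] ∷ []
sublists (x ∷ xs) = map (x ∷_) (sublists xs) ++ sublists xs

minimum⁺ : ℕ → List ℕ → ℕ
minimum⁺ x xs = foldr _⊓_ x xs

isSchreier : List ℕ → Bool
isSchreier []       = false
isSchreier (x ∷ xs) = length (x ∷ xs) ≤ᵇ minimum⁺ x xs

memᵇ : ℕ → List ℕ → Bool
memᵇ a = any (a ≡ᵇ_)

-- The set {k, 2k, ..., nk} as a list of (distinct, when k ≥ 1) elements.
multiples : ℕ → ℕ → List ℕ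
multiples k n = applyUpTo (λ i → suc i * k) n

s : ℕ → ℕ → ℕ
s k n = length (filterᵇ (λ F → isSchreier F ∧ memᵇ (n * k) F) (sublists (multiples k n)))

module Submission where

-- Grouping the Schreier sets F ⊆ {k, …, nk} with nk ∈ F by their minimum ik, the other elements of F
-- form a subset of size ≤ ik − 2 of the n − i − 1 multiples strictly between. Weakening the Schreier
-- condition to |F| + j ≤ min F + 1 gives counts s⁽ʲ⁾ (with s⁽¹⁾ = s), and Pascal's rule for these bounded
-- subset counts gives s⁽ʲ⁾(n + 1) − s⁽ʲ⁾(n) = s⁽ʲ⁺¹⁾(n) whenever j < nk. Hence the k-th backward
-- difference of s at n is s⁽ᵏ⁺¹⁾(n − k); dropping the multiple k, which can never be the minimum for
-- j = k + 1, turns this into s(n − k − 1), and expanding the backward difference binomially gives the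
-- recurrence. For n ≤ k the size bound excludes nothing, and for n = k + 1 it excludes only the full set.

open import Defs
open import Data.Bool using (Bool; true; false; _∧_; _∨_; if_then_else_)
open import Data.Bool.Properties using (∧-zeroʳ; ∧-identityʳ)
open import Data.Nat using (ℕ; zero; suc; pred; _+_; _*_; _∸_; _^_; _⊓_; _≤_; _<_; _≤ᵇ_; _≡ᵇ_; s≤s; z<s)
open import Data.Nat.Properties
open import Data.Nat.Combinatorics using (_C_; nCk+nC[k+1]≡[n+1]C[k+1]; k>n⇒nCk≡0)
open import Data.List using (List; []; _∷_; _++_; map; length; foldr; filterᵇ; applyUpTo)
open import Data.List.Relation.Unary.All using (All; []; _∷_; universal-U)
open import Data.List.Relation.Unary.All.Properties using (applyUpTo⁺₂)
open import Data.Product using (_×_; _,_)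
open import Function using (_∘_)
open import Relation.Nullary.Decidable using (dec-true; dec-false)
open import Relation.Binary.PropositionalEquality
open import Relation.Unary using (U)
open import Algebra.Properties.CommutativeSemigroup +-commutativeSemigroup using () renaming (interchange to +-interchange)

private
  variable
    A B : Set

countSublists : (List A → Bool) → List A → ℕ
countSublists P xs = length (filterᵇ P (sublists xs))

private
  length-filterᵇ-++ : ∀ (P : A → Bool) xs ys →
    length (filterᵇ P (xs ++ ys)) ≡ length (filterᵇ P xs) + length (filterᵇ P ys)
  length-filterᵇ-++ P []       ys = refl
  length-filterᵇ-++ P (x ∷ xs) ys with P x
  ... | true  = cong suc (length-filterᵇ-++ P xs ys)
  ... | false = length-filterᵇ-++ P xs ys

  length-filterᵇ-map : ∀ (P : B → Bool) (f : A → B) xs →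
    length (filterᵇ P (map f xs)) ≡ length (filterᵇ (P ∘ f) xs)
  length-filterᵇ-map P f []       = refl
  length-filterᵇ-map P f (x ∷ xs) with P (f x)
  ... | true  = cong suc (length-filterᵇ-map P f xs)
  ... | false = length-filterᵇ-map P f xs

countSublists-[] : ∀ (P : List A → Bool) → countSublists P [] ≡ (if P [] then 1 else 0)
countSublists-[] P with P []
... | true  = refl
... | false = refl

countSublists-∷ : ∀ (P : List A → Bool) x xs →
  countSublists P (x ∷ xs) ≡ countSublists (P ∘ (x ∷_)) xs + countSublists P xs
countSublists-∷ P x xs = begin
  length (filterᵇ P (map (x ∷_) (sublists xs) ++ sublists xs))
    ≡⟨ length-filterᵇ-++ P (map (x ∷_) (sublists xs)) (sublists xs) ⟩
  length (filterᵇ P (map (x ∷_) (sublists xs))) + countSublists P xs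
    ≡⟨ cong (_+ countSublists P xs) (length-filterᵇ-map P (x ∷_) (sublists xs)) ⟩
  countSublists (P ∘ (x ∷_)) xs + countSublists P xs ∎
  where open ≡-Reasoning

countSublists-cong : ∀ {R : A → Set} {P Q : List A → Bool} {xs} →
  (∀ F → All R F → P F ≡ Q F) → All R xs → countSublists P xs ≡ countSublists Q xs
countSublists-cong {P = P} {Q} P≐Q [] = begin
  countSublists P []           ≡⟨ countSublists-[] P ⟩
  (if P [] then 1 else 0)      ≡⟨ cong (if_then 1 else 0) (P≐Q [] []) ⟩
  (if Q [] then 1 else 0)      ≡⟨ countSublists-[] Q ⟨
  countSublists Q []           ∎
  where open ≡-Reasoning
countSublists-cong {P = P} {Q} {x ∷ xs} P≐Q (Rx ∷ Rxs) = begin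
  countSublists P (x ∷ xs)                                ≡⟨ countSublists-∷ P x xs ⟩
  countSublists (P ∘ (x ∷_)) xs + countSublists P xs
    ≡⟨ cong₂ _+_ (countSublists-cong (λ F RF → P≐Q (x ∷ F) (Rx ∷ RF)) Rxs) (countSublists-cong P≐Q Rxs) ⟩
  countSublists (Q ∘ (x ∷_)) xs + countSublists Q xs      ≡⟨ countSublists-∷ Q x xs ⟨
  countSublists Q (x ∷ xs)                                ∎
  where open ≡-Reasoning

-- smallSubsets b L is the number of subsets with fewer than b elements of an L-element set.
smallSubsets : ℕ → ℕ → ℕ
smallSubsets zero    L       = 0
smallSubsets (suc b) zero    = 1
smallSubsets (suc b) (suc L) = smallSubsets (suc b) L + smallSubsets b L

smallSubsets-suc : ∀ b L → smallSubsets b (suc L) ≡ smallSubsets b L + smallSubsets (pred b) L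
smallSubsets-suc zero    L = refl
smallSubsets-suc (suc b) L = refl

smallSubsets-zero : ∀ {b} → 0 < b → smallSubsets b 0 ≡ 1
smallSubsets-zero {suc b} _ = refl

smallSubsets-∸-zero : ∀ t x → smallSubsets (x ∸ t) 0 ≡ (if suc t ≤ᵇ x then 1 else 0)
smallSubsets-∸-zero zero    zero    = refl
smallSubsets-∸-zero zero    (suc x) = refl
smallSubsets-∸-zero (suc t) zero    = refl
smallSubsets-∸-zero (suc t) (suc x) = smallSubsets-∸-zero t x

smallSubsets-all : ∀ {b L} → L < b → smallSubsets b L ≡ 2 ^ L
smallSubsets-all {suc b} {zero}  _         = refl
smallSubsets-all {suc b} {suc L} (s≤s L<b) =
  trans (cong₂ _+_ (smallSubsets-all (m<n⇒m<1+n L<b)) (smallSubsets-all L<b))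
        (cong (2 ^ L +_) (sym (+-identityʳ (2 ^ L))))

smallSubsets-diagonal : ∀ L → smallSubsets L L + 1 ≡ 2 ^ L
smallSubsets-diagonal zero    = refl
smallSubsets-diagonal (suc L) = begin
  smallSubsets (suc L) L + smallSubsets L L + 1    ≡⟨ +-assoc (smallSubsets (suc L) L) _ 1 ⟩
  smallSubsets (suc L) L + (smallSubsets L L + 1)  ≡⟨ cong₂ _+_ (smallSubsets-all {L = L} ≤-refl) (smallSubsets-diagonal L) ⟩
  2 ^ L + 2 ^ L                                    ≡⟨ cong (2 ^ L +_) (+-identityʳ (2 ^ L)) ⟨
  2 ^ suc L                                        ∎
  where open ≡-Reasoning

StrictlyIncreasing : (ℕ → ℕ) → Set
StrictlyIncreasing f = ∀ i → f i < f (suc i)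

private
  variable
    f : ℕ → ℕ

strictlyIncreasing-head< : StrictlyIncreasing f → ∀ i → f 0 < f (suc i)
strictlyIncreasing-head< f↑ zero    = f↑ 0
strictlyIncreasing-head< f↑ (suc i) = <-trans (strictlyIncreasing-head< f↑ i) (f↑ (suc i))

private
  >⇒≡ᵇ-false : ∀ {N y} → y < N → (N ≡ᵇ y) ≡ false
  >⇒≡ᵇ-false y<N = dec-false (_ ≟ _) (>⇒≢ y<N)

  ≡ᵇ-refl : ∀ n → (n ≡ᵇ n) ≡ true
  ≡ᵇ-refl n = dec-true (n ≟ n) refl

  countSublists-singleton : ∀ (P : List A → Bool) y → P [] ≡ false →
    countSublists P (y ∷ []) ≡ (if P (y ∷ []) then 1 else 0)
  countSublists-singleton P y P[]≡false = begin
    countSublists P (y ∷ [])                                 ≡⟨ countSublists-∷ P y [] ⟩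
    countSublists (P ∘ (y ∷_)) [] + countSublists P []
      ≡⟨ cong₂ _+_ (countSublists-[] (P ∘ (y ∷_))) (countSublists-[] P) ⟩
    (if P (y ∷ []) then 1 else 0) + (if P [] then 1 else 0)  ≡⟨ cong (λ b → (if P (y ∷ []) then 1 else 0) + (if b then 1 else 0)) P[]≡false ⟩
    (if P (y ∷ []) then 1 else 0) + 0                        ≡⟨ +-identityʳ _ ⟩
    (if P (y ∷ []) then 1 else 0)                            ∎
    where open ≡-Reasoning

countSublists-bounded-∋last : StrictlyIncreasing f → ∀ x t L →
  countSublists (λ F → (t + length F ≤ᵇ x) ∧ memᵇ (f L) F) (applyUpTo f (suc L))
    ≡ smallSubsets (x ∸ t) L
countSublists-bounded-∋last {f} f↑ x t zero = begin
  countSublists P (f 0 ∷ [])     ≡⟨ countSublists-singleton P (f 0) (∧-zeroʳ _) ⟩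
  (if P (f 0 ∷ []) then 1 else 0) ≡⟨ cong (if_then 1 else 0) P[f0] ⟩
  (if suc t ≤ᵇ x then 1 else 0)   ≡⟨ smallSubsets-∸-zero t x ⟨
  smallSubsets (x ∸ t) 0          ∎
  where
    open ≡-Reasoning
    P : List ℕ → Bool
    P F = (t + length F ≤ᵇ x) ∧ memᵇ (f 0) F
    P[f0] : P (f 0 ∷ []) ≡ (suc t ≤ᵇ x)
    P[f0] = trans (cong₂ (λ a b → (a ≤ᵇ x) ∧ (b ∨ false)) (+-comm t 1) (≡ᵇ-refl (f 0))) (∧-identityʳ _)
countSublists-bounded-∋last {f} f↑ x t (suc L) = begin
  countSublists (P t) (f 0 ∷ ys)
    ≡⟨ countSublists-∷ (P t) (f 0) ys ⟩
  countSublists (P t ∘ (f 0 ∷_)) ys + countSublists (P t) ys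
    ≡⟨ cong (_+ countSublists (P t) ys) (countSublists-cong shift (universal-U ys)) ⟩
  countSublists (P (suc t)) ys + countSublists (P t) ys
    ≡⟨ cong₂ _+_ (countSublists-bounded-∋last (f↑ ∘ suc) x (suc t) L) (countSublists-bounded-∋last (f↑ ∘ suc) x t L) ⟩
  smallSubsets (x ∸ suc t) L + smallSubsets (x ∸ t) L
    ≡⟨ +-comm (smallSubsets (x ∸ suc t) L) _ ⟩
  smallSubsets (x ∸ t) L + smallSubsets (x ∸ suc t) L
    ≡⟨ cong (λ b → smallSubsets (x ∸ t) L + smallSubsets b L) (pred[m∸n]≡m∸[1+n] x t) ⟨
  smallSubsets (x ∸ t) L + smallSubsets (pred (x ∸ t)) L
    ≡⟨ smallSubsets-suc (x ∸ t) L ⟨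
  smallSubsets (x ∸ t) (suc L) ∎
  where
    open ≡-Reasoning
    ys : List ℕ
    ys = applyUpTo (f ∘ suc) (suc L)
    P : ℕ → List ℕ → Bool
    P s F = (s + length F ≤ᵇ x) ∧ memᵇ (f (suc L)) F
    shift : ∀ F → All U F → P t (f 0 ∷ F) ≡ P (suc t) F
    shift F _ = cong₂ _∧_ (cong (_≤ᵇ x) (+-suc t (length F)))
                          (cong (_∨ memᵇ (f (suc L)) F) (>⇒≡ᵇ-false (strictlyIncreasing-head< f↑ L)))

-- For increasing f and j ≤ f (L ∸ 1), schreierCount j f L counts, by their minimum, the sets
-- F ⊆ {f 0, …, f (L ∸ 1)} with f (L ∸ 1) ∈ F and |F| + j ≤ min F + 1; j = 1 is the Schreier condition.
schreierCount : ℕ → (ℕ → ℕ) → ℕ → ℕ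
schreierCount j f zero          = 0
schreierCount j f (suc zero)    = 1
schreierCount j f (suc (suc L)) = smallSubsets (f 0 ∸ j) L + schreierCount j (f ∘ suc) (suc L)

minimum⁺-lowerBound : ∀ {y F} → All (y ≤_) F → minimum⁺ y F ≡ y
minimum⁺-lowerBound []                      = refl
minimum⁺-lowerBound {F = z ∷ F} (y≤z ∷ y≤F) = trans (cong (z ⊓_) (minimum⁺-lowerBound y≤F)) (m≥n⇒m⊓n≡n y≤z)

countSublists-schreier-∋last : StrictlyIncreasing f → ∀ L → 0 < f L →
  countSublists (λ F → isSchreier F ∧ memᵇ (f L) F) (applyUpTo f (suc L)) ≡ schreierCount 1 f (suc L)
countSublists-schreier-∋last {f} f↑ zero 0<f0 =
  trans (countSublists-singleton (λ F → isSchreier F ∧ memᵇ (f 0) F) (f 0) refl)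
        (cong (if_then 1 else 0) (cong₂ _∧_ (dec-true (1 ≤? f 0) 0<f0) (cong (_∨ false) (≡ᵇ-refl (f 0)))))
countSublists-schreier-∋last {f} f↑ (suc L) 0<fL = begin
  countSublists P (f 0 ∷ ys)
    ≡⟨ countSublists-∷ P (f 0) ys ⟩
  countSublists (P ∘ (f 0 ∷_)) ys + countSublists P ys
    ≡⟨ cong₂ _+_ (countSublists-cong minimum-is-head (applyUpTo⁺₂ (f ∘ suc) (suc L) f0≤))
                 (countSublists-schreier-∋last (f↑ ∘ suc) L 0<fL) ⟩
  countSublists (λ F → (1 + length F ≤ᵇ f 0) ∧ memᵇ (f (suc L)) F) ys + schreierCount 1 (f ∘ suc) (suc L)
    ≡⟨ cong (_+ schreierCount 1 (f ∘ suc) (suc L)) (countSublists-bounded-∋last (f↑ ∘ suc) (f 0) 1 L) ⟩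
  schreierCount 1 f (suc (suc L)) ∎
  where
    open ≡-Reasoning
    ys : List ℕ
    ys = applyUpTo (f ∘ suc) (suc L)
    P : List ℕ → Bool
    P F = isSchreier F ∧ memᵇ (f (suc L)) F
    f0≤ : ∀ i → f 0 ≤ f (suc i)
    f0≤ i = <⇒≤ (strictlyIncreasing-head< f↑ i)
    minimum-is-head : ∀ F → All (f 0 ≤_) F → P (f 0 ∷ F) ≡ ((1 + length F ≤ᵇ f 0) ∧ memᵇ (f (suc L)) F)
    minimum-is-head F f0≤F = cong₂ _∧_ (cong (suc (length F) ≤ᵇ_) (minimum⁺-lowerBound f0≤F))
                                       (cong (_∨ memᵇ (f (suc L)) F) (>⇒≡ᵇ-false (strictlyIncreasing-head< f↑ L)))

schreierCount-step : ∀ j f L → j < f L →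
  schreierCount j f (suc (suc L)) ≡ schreierCount j f (suc L) + schreierCount (suc j) f (suc L)
schreierCount-step j f zero j<f0 = cong (_+ 1) (smallSubsets-zero (m<n⇒0<n∸m j<f0))
schreierCount-step j f (suc L) j<f = begin
  smallSubsets b (suc L) + schreierCount j (f ∘ suc) (suc (suc L))
    ≡⟨ cong₂ _+_ (smallSubsets-suc b L) (schreierCount-step j (f ∘ suc) L j<f) ⟩
  (smallSubsets b L + smallSubsets (pred b) L) + (schreierCount j (f ∘ suc) (suc L) + schreierCount (suc j) (f ∘ suc) (suc L))
    ≡⟨ +-interchange (smallSubsets b L) _ _ _ ⟩
  (smallSubsets b L + schreierCount j (f ∘ suc) (suc L)) + (smallSubsets (pred b) L + schreierCount (suc j) (f ∘ suc) (suc L))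
    ≡⟨ cong (λ c → schreierCount j f (suc (suc L)) + (smallSubsets c L + schreierCount (suc j) (f ∘ suc) (suc L)))
            (pred[m∸n]≡m∸[1+n] (f 0) j) ⟩
  schreierCount j f (suc (suc L)) + schreierCount (suc j) f (suc (suc L)) ∎
  where
    open ≡-Reasoning
    b : ℕ
    b = f 0 ∸ j

schreierCount-shift : ∀ k f → (∀ i → f (suc i) ≡ k + f i) → ∀ L →
  schreierCount (suc k) (f ∘ suc) L ≡ schreierCount 1 f L
schreierCount-shift k f f+k zero          = refl
schreierCount-shift k f f+k (suc zero)    = refl
schreierCount-shift k f f+k (suc (suc L)) =
  cong₂ _+_ (cong (λ b → smallSubsets b L) f1∸[1+k]≡f0∸1) (schreierCount-shift k (f ∘ suc) (f+k ∘ suc) (suc L))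
  where
    f1∸[1+k]≡f0∸1 : f 1 ∸ suc k ≡ f 0 ∸ 1
    f1∸[1+k]≡f0∸1 = begin
      f 1 ∸ suc k       ≡⟨ cong₂ _∸_ (f+k 0) (+-comm 1 k) ⟩
      k + f 0 ∸ (k + 1) ≡⟨ [m+n]∸[m+o]≡n∸o k (f 0) 1 ⟩
      f 0 ∸ 1           ∎
      where open ≡-Reasoning

schreierCount-drop : ∀ k f → f 0 ≤ k → (∀ i → f (suc i) ≡ k + f i) → ∀ L →
  schreierCount (suc k) f (suc (suc L)) ≡ schreierCount 1 f (suc L)
schreierCount-drop k f f0≤k f+k L =
  trans (cong (λ b → smallSubsets b L + schreierCount (suc k) (f ∘ suc) (suc L)) (m≤n⇒m∸n≡0 (m≤n⇒m≤1+n f0≤k)))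
        (schreierCount-shift k f f+k (suc L))

schreierCount-unconstrained : ∀ f L → (∀ i → suc L ≤ f i) → schreierCount 1 f (suc L) ≡ 2 ^ L
schreierCount-unconstrained f zero    _   = refl
schreierCount-unconstrained f (suc L) L<f =
  trans (cong₂ _+_ (smallSubsets-all (pred-mono-< (L<f 0))) (schreierCount-unconstrained (f ∘ suc) L (λ i → <⇒≤ (L<f (suc i)))))
        (cong (2 ^ L +_) (sym (+-identityʳ (2 ^ L))))

schreierCount-firstFailure : ∀ f L → f 0 ≡ suc L → (∀ i → suc L ≤ f (suc i)) →
  schreierCount 1 f (suc (suc L)) ≡ 2 ^ suc L ∸ 1
schreierCount-firstFailure f L f0≡1+L 1+L≤f = begin
  smallSubsets (f 0 ∸ 1) L + schreierCount 1 (f ∘ suc) (suc L)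
    ≡⟨ cong₂ _+_ (cong (λ b → smallSubsets (b ∸ 1) L) f0≡1+L) (schreierCount-unconstrained (f ∘ suc) L 1+L≤f) ⟩
  smallSubsets L L + 2 ^ L          ≡⟨ m+n∸n≡m (smallSubsets L L + 2 ^ L) 1 ⟨
  smallSubsets L L + 2 ^ L + 1 ∸ 1  ≡⟨ cong (_∸ 1) all-but-one ⟩
  2 ^ suc L ∸ 1                     ∎
  where
    open ≡-Reasoning
    all-but-one : smallSubsets L L + 2 ^ L + 1 ≡ 2 ^ suc L
    all-but-one = begin
      smallSubsets L L + 2 ^ L + 1    ≡⟨ +-assoc (smallSubsets L L) (2 ^ L) 1 ⟩
      smallSubsets L L + (2 ^ L + 1)  ≡⟨ cong (smallSubsets L L +_) (+-comm (2 ^ L) 1) ⟩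
      smallSubsets L L + (1 + 2 ^ L)  ≡⟨ +-assoc (smallSubsets L L) 1 (2 ^ L) ⟨
      smallSubsets L L + 1 + 2 ^ L    ≡⟨ cong (_+ 2 ^ L) (smallSubsets-diagonal L) ⟩
      2 ^ L + 2 ^ L                   ≡⟨ cong (2 ^ L +_) (+-identityʳ (2 ^ L)) ⟨
      2 ^ suc L                       ∎

-- Imported only here: ℤ's prefix +_ would make the ℕ sections (m +_) above ambiguous.
open import Data.Integer using (ℤ; +_; -[1+_]; -_)
  renaming (_+_ to _+ℤ_; _*_ to _*ℤ_; _^_ to _^ℤ_; _-_ to _-ℤ_)
import Data.Integer.Properties as ℤ
open import Data.Integer.Solver using (module +-*-Solver)
open import Algebra.Properties.CommutativeSemigroup ℤ.+-commutativeSemigroup using () renaming (interchange to +ℤ-interchange)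

sumℤ : ℕ → (ℕ → ℤ) → ℤ
sumℤ m g = foldr _+ℤ_ (+ 0) (applyUpTo g m)

sumℤ-cong : ∀ m {g h : ℕ → ℤ} → (∀ i → g i ≡ h i) → sumℤ m g ≡ sumℤ m h
sumℤ-cong zero    g≗h = refl
sumℤ-cong (suc m) g≗h = cong₂ _+ℤ_ (g≗h 0) (sumℤ-cong m (g≗h ∘ suc))

sumℤ-+ : ∀ m (g h : ℕ → ℤ) → sumℤ m (λ i → g i +ℤ h i) ≡ sumℤ m g +ℤ sumℤ m h
sumℤ-+ zero    g h = refl
sumℤ-+ (suc m) g h = trans (cong (g 0 +ℤ h 0 +ℤ_) (sumℤ-+ m (g ∘ suc) (h ∘ suc))) (+ℤ-interchange (g 0) (h 0) _ _)

sumℤ-neg : ∀ m (g : ℕ → ℤ) → sumℤ m (λ i → - g i) ≡ - sumℤ m g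
sumℤ-neg zero    g = refl
sumℤ-neg (suc m) g = trans (cong (- g 0 +ℤ_) (sumℤ-neg m (g ∘ suc))) (sym (ℤ.neg-distrib-+ (g 0) _))

sumℤ-init-last : ∀ m (g : ℕ → ℤ) → sumℤ (suc m) g ≡ sumℤ m g +ℤ g m
sumℤ-init-last zero    g = trans (ℤ.+-identityʳ (g 0)) (sym (ℤ.+-identityˡ (g 0)))
sumℤ-init-last (suc m) g = trans (cong (g 0 +ℤ_) (sumℤ-init-last m (g ∘ suc))) (sym (ℤ.+-assoc (g 0) _ _))

-- ∑_{i=1}^{k} (-1)^{i+1} C(k,i) g(n-i), indexed by j = i - 1 as in the recurrence.
binomialSum : ℕ → (ℕ → ℤ) → ℕ → ℤ
binomialSum k g n = sumℤ k (λ j → ((-[1+ 0 ] ^ℤ (suc j + 1)) *ℤ (+ (k C suc j))) *ℤ g (n ∸ suc j))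

binomialSum-suc : ∀ k g n →
  binomialSum (suc k) g n ≡ (binomialSum k g n +ℤ g (n ∸ 1)) -ℤ binomialSum k g (n ∸ 1)
binomialSum-suc k g n = begin
  binomialSum (suc k) g n
    ≡⟨ sumℤ-cong (suc k) pascal ⟩
  sumℤ (suc k) (λ j → lower j +ℤ upper j)
    ≡⟨ sumℤ-+ (suc k) lower upper ⟩
  sumℤ (suc k) lower +ℤ sumℤ (suc k) upper
    ≡⟨ cong₂ _+ℤ_ lower-sum upper-sum ⟩
  (g (n ∸ 1) -ℤ binomialSum k g (n ∸ 1)) +ℤ binomialSum k g n
    ≡⟨ solve 3 (λ a b c → (a :- b) :+ c := (c :+ a) :- b) refl (g (n ∸ 1)) _ _ ⟩
  (binomialSum k g n +ℤ g (n ∸ 1)) -ℤ binomialSum k g (n ∸ 1) ∎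
  where
    open ≡-Reasoning
    open +-*-Solver
    sign : ℕ → ℤ
    sign j = -[1+ 0 ] ^ℤ (suc j + 1)
    lower upper : ℕ → ℤ
    lower j = (sign j *ℤ + (k C j)) *ℤ g (n ∸ suc j)
    upper j = (sign j *ℤ + (k C suc j)) *ℤ g (n ∸ suc j)

    pascal : ∀ j → (sign j *ℤ + (suc k C suc j)) *ℤ g (n ∸ suc j) ≡ lower j +ℤ upper j
    pascal j = begin
      (sign j *ℤ + (suc k C suc j)) *ℤ g (n ∸ suc j)
        ≡⟨ cong (λ c → (sign j *ℤ + c) *ℤ g (n ∸ suc j)) (nCk+nC[k+1]≡[n+1]C[k+1] k j) ⟨
      (sign j *ℤ + (k C j + k C suc j)) *ℤ g (n ∸ suc j)
        ≡⟨ cong (λ c → (sign j *ℤ c) *ℤ g (n ∸ suc j)) (ℤ.pos-+ (k C j) (k C suc j)) ⟩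
      (sign j *ℤ (+ (k C j) +ℤ + (k C suc j))) *ℤ g (n ∸ suc j)
        ≡⟨ solve 4 (λ s a b x → (s :* (a :+ b)) :* x := (s :* a) :* x :+ (s :* b) :* x) refl
                 (sign j) (+ (k C j)) (+ (k C suc j)) (g (n ∸ suc j)) ⟩
      lower j +ℤ upper j ∎

    -- The terms of index ≥ 1 are those of binomialSum k g (n ∸ 1) with one more sign change.
    lower-sum : sumℤ (suc k) lower ≡ g (n ∸ 1) -ℤ binomialSum k g (n ∸ 1)
    lower-sum = cong₂ _+ℤ_ (ℤ.*-identityˡ (g (n ∸ 1)))
                  (trans (sumℤ-cong k shifted) (sumℤ-neg k _))
      where
        shifted : ∀ j → lower (suc j) ≡ - ((sign j *ℤ + (k C suc j)) *ℤ g (n ∸ 1 ∸ suc j))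
        shifted j = trans (cong (λ m → (sign (suc j) *ℤ + (k C suc j)) *ℤ g m) (sym (∸-+-assoc n 1 (suc j))))
                          (solve 3 (λ s c x → ((con -[1+ 0 ] :* s) :* c) :* x := :- ((s :* c) :* x)) refl
                                 (sign j) (+ (k C suc j)) (g (n ∸ 1 ∸ suc j)))

    upper-sum : sumℤ (suc k) upper ≡ binomialSum k g n
    upper-sum = begin
      sumℤ (suc k) upper       ≡⟨ sumℤ-init-last k upper ⟩
      sumℤ k upper +ℤ upper k  ≡⟨ cong (sumℤ k upper +ℤ_) upper-k≡0 ⟩
      sumℤ k upper +ℤ + 0      ≡⟨ ℤ.+-identityʳ _ ⟩
      binomialSum k g n        ∎
      where
        upper-k≡0 : upper k ≡ + 0
        upper-k≡0 = begin
          (sign k *ℤ + (k C suc k)) *ℤ g (n ∸ suc k) ≡⟨ cong (λ c → (sign k *ℤ + c) *ℤ g (n ∸ suc k)) (k>n⇒nCk≡0 (n<1+n k)) ⟩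
          (sign k *ℤ + 0) *ℤ g (n ∸ suc k)          ≡⟨ cong (_*ℤ g (n ∸ suc k)) (ℤ.*-zeroʳ (sign k)) ⟩
          + 0 *ℤ g (n ∸ suc k)                      ≡⟨ ℤ.*-zeroˡ (g (n ∸ suc k)) ⟩
          + 0                                       ∎

∇ : ℕ → (ℕ → ℤ) → ℕ → ℤ
∇ zero    g n = g n
∇ (suc j) g n = ∇ j g n -ℤ ∇ j g (n ∸ 1)

∇-cong : ∀ j {g h : ℕ → ℤ} → (∀ m → g m ≡ h m) → ∀ n → ∇ j g n ≡ ∇ j h n
∇-cong zero    g≗h n = g≗h n
∇-cong (suc j) g≗h n = cong₂ _-ℤ_ (∇-cong j g≗h n) (∇-cong j g≗h (n ∸ 1))

∇-expansion : ∀ j g n → ∇ j g n ≡ g n -ℤ binomialSum j g n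
∇-expansion zero    g n = sym (ℤ.+-identityʳ (g n))
∇-expansion (suc j) g n = begin
  ∇ j g n -ℤ ∇ j g (n ∸ 1)
    ≡⟨ cong₂ _-ℤ_ (∇-expansion j g n) (∇-expansion j g (n ∸ 1)) ⟩
  (g n -ℤ binomialSum j g n) -ℤ (g (n ∸ 1) -ℤ binomialSum j g (n ∸ 1))
    ≡⟨ solve 4 (λ a b c d → (a :- b) :- (c :- d) := a :- ((b :+ c) :- d)) refl (g n) _ _ _ ⟩
  g n -ℤ ((binomialSum j g n +ℤ g (n ∸ 1)) -ℤ binomialSum j g (n ∸ 1))
    ≡⟨ cong (g n -ℤ_) (binomialSum-suc j g n) ⟨
  g n -ℤ binomialSum (suc j) g n ∎
  where
    open ≡-Reasoning
    open +-*-Solver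

∇-schreierCount : ∀ f j M → (∀ i → j < f (suc i)) →
  ∇ j (λ m → + schreierCount 1 f m) (j + 2 + M) ≡ + schreierCount (suc j) f (2 + M)
∇-schreierCount f zero    M _    = refl
∇-schreierCount f (suc j) M j<f = begin
  ∇ j g (suc (j + 2 + M)) -ℤ ∇ j g (j + 2 + M)
    ≡⟨ cong (λ m → ∇ j g m -ℤ ∇ j g (j + 2 + M)) (+-suc (j + 2) M) ⟨
  ∇ j g (j + 2 + suc M) -ℤ ∇ j g (j + 2 + M)
    ≡⟨ cong₂ _-ℤ_ (∇-schreierCount f j (suc M) j<f′) (∇-schreierCount f j M j<f′) ⟩
  + schreierCount (suc j) f (3 + M) -ℤ + schreierCount (suc j) f (2 + M)
    ≡⟨ cong (λ c → + c -ℤ + schreierCount (suc j) f (2 + M)) (schreierCount-step (suc j) f (suc M) (j<f M)) ⟩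
  + (a + b) -ℤ + a
    ≡⟨ cong (_-ℤ + a) (ℤ.pos-+ a b) ⟩
  (+ a +ℤ + b) -ℤ + a
    ≡⟨ solve 2 (λ x y → (x :+ y) :- x := y) refl (+ a) (+ b) ⟩
  + schreierCount (2 + j) f (2 + M) ∎
  where
    open ≡-Reasoning
    open +-*-Solver
    g : ℕ → ℤ
    g m = + schreierCount 1 f m
    a b : ℕ
    a = schreierCount (suc j) f (2 + M)
    b = schreierCount (2 + j) f (2 + M)
    j<f′ : ∀ i → j < f (suc i)
    j<f′ i = <⇒≤ (j<f i)

multiple : ℕ → ℕ → ℕ
multiple k i = suc i * k

s≡schreierCount : ∀ k → 0 < k → ∀ n → s k n ≡ schreierCount 1 (multiple k) n
s≡schreierCount k 0<k zero    = refl
s≡schreierCount k 0<k (suc L) =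
  countSublists-schreier-∋last (λ i → m<n+m (suc i * k) 0<k) L (≤-trans 0<k (m≤m+n k (L * k)))

s-initial : ∀ k → 0 < k → ∀ L → suc L ≤ k → s k (suc L) ≡ 2 ^ L
s-initial k 0<k L 1+L≤k = trans (s≡schreierCount k 0<k (suc L))
  (schreierCount-unconstrained (multiple k) L (λ i → ≤-trans 1+L≤k (m≤m+n k (i * k))))

s-firstFailure : ∀ k′ → s (suc k′) (suc (suc k′)) ≡ 2 ^ suc k′ ∸ 1
s-firstFailure k′ = trans (s≡schreierCount (suc k′) z<s (suc (suc k′)))
  (schreierCount-firstFailure (multiple (suc k′)) k′ (*-identityˡ (suc k′)) (λ i → m≤m+n (suc k′) _))

s-∇ : ∀ k → 0 < k → ∀ n → k + 2 ≤ n → ∇ k (λ m → + s k m) n ≡ + s k (n ∸ (k + 1))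
s-∇ k 0<k n k+2≤n = subst KthDifference (m+[n∸m]≡n k+2≤n) (s-∇-from (n ∸ (k + 2)))
  where
    KthDifference : ℕ → Set
    KthDifference n = ∇ k (λ m → + s k m) n ≡ + s k (n ∸ (k + 1))

    s-∇-from : ∀ M → KthDifference (k + 2 + M)
    s-∇-from M = begin
      ∇ k (λ m → + s k m) (k + 2 + M)
        ≡⟨ ∇-cong k (cong +_ ∘ s≡schreierCount k 0<k) (k + 2 + M) ⟩
      ∇ k (λ m → + schreierCount 1 (multiple k) m) (k + 2 + M)
        ≡⟨ ∇-schreierCount (multiple k) k M (λ i → m<m+n k (≤-trans 0<k (m≤m+n k _))) ⟩
      + schreierCount (suc k) (multiple k) (2 + M)
        ≡⟨ cong +_ (schreierCount-drop k (multiple k) (≤-reflexive (+-identityʳ k)) (λ _ → refl) M) ⟩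
      + schreierCount 1 (multiple k) (suc M)
        ≡⟨ cong +_ (s≡schreierCount k 0<k (suc M)) ⟨
      + s k (suc M)
        ≡⟨ cong (+_ ∘ s k) (trans (cong (_∸ (k + 1)) (+-assoc k 2 M)) ([m+n]∸[m+o]≡n∸o k (2 + M) 1)) ⟨
      + s k (k + 2 + M ∸ (k + 1)) ∎
      where open ≡-Reasoning

s-recurrence : ∀ k → 0 < k → ∀ n → k + 2 ≤ n →
  + s k n ≡ binomialSum k (λ m → + s k m) n +ℤ + s k (n ∸ (k + 1))
s-recurrence k 0<k n k+2≤n = begin
  S n                          ≡⟨ solve 2 (λ x y → x := y :+ (x :- y)) refl (S n) R ⟩
  R +ℤ (S n -ℤ R)              ≡⟨ cong (R +ℤ_) (∇-expansion k S n) ⟨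
  R +ℤ ∇ k S n                 ≡⟨ cong (R +ℤ_) (s-∇ k 0<k n k+2≤n) ⟩
  R +ℤ S (n ∸ (k + 1))         ∎
  where
    open ≡-Reasoning
    open +-*-Solver
    S : ℕ → ℤ
    S m = + s k m
    R : ℤ
    R = binomialSum k S n

corollary1p3 : (k : ℕ) → 1 ≤ k →
    ((n : ℕ) → 1 ≤ n → n ≤ k → s k n ≡ 2 ^ (n ∸ 1))
    × (s k (k + 1) ≡ 2 ^ k ∸ 1)
    × ((n : ℕ) → k + 2 ≤ n →
        + s k n ≡ foldr _+ℤ_ (+ 0) (applyUpTo (λ j → ((-[1+ 0 ] ^ℤ (suc j + 1)) *ℤ (+ (k C suc j))) *ℤ (+ s k (n ∸ suc j))) k)
                  +ℤ + s k (n ∸ (k + 1)))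
corollary1p3 k@(suc k′) 0<k =
    (λ { (suc L) _ → s-initial k 0<k L })
  , trans (cong (s k) (+-comm k 1)) (s-firstFailure k′)
  , s-recurrence k 0<k
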